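{- Let $G=(V,E)$ be a temporal graph and $T$ the BFS tree of $G$ rooted at $s$ with starting time $t_s$. For a vertex $v$, let $O(v)$ be the set of occurrences of $v$ in $T$. Then for any two distinct $v_1,v_2\in O(v)$, $dist(v_1)\neq dist(v_2)$.
   Context: A temporal graph is $G=(V,E)$ with $V$ a finite vertex set and $E$ a finite set of temporal edges $(u,v,t)$, $u\neq v$, $t$ real; distinct temporal edges from $u$ to $v$ have distinct times. BFS from $s$ with starting time $t_s$: keep $\sigma(x)$ (time most recently assigned to $x$), initially $\infty$; FIFO queue $Q$ of records $(x,d,\tau,p)$ (vertex, hop count, time, predecessor). Set $\sigma(s)=t_s$, push $(s,0,t_s,\text{none})$. While $Q\neq\emptyset$: pop $(u,d_u,\tau_u,p_u)$; for each out-neighbor $v$ of $u$ with $E_{u,v}\neq\emptyset$, where $E_{u,v}$ is the set of not-yet-traversed edges $(u,v,t)\in E$ with $\tau_u\le t$, traverse the edge $(u,v,t)$ of $E_{u,v}$ of minimum time; then (i) if $Q$ has no record of $v$: if $\sigma(v)>t$, set $\sigma(v)=t$ and push $(v,d_u+1,t,\text{popped record})$; (ii) else if $Q$ has a record of $v$ with hop count $d_u+1$: if $\sigma(v)>t$, set $\sigma(v)=t$ and set that record's time to $t$ and predecessor to the popped record; (iii) else (the record of $v$ in $Q$ has hop count $d_u$): if $\sigma(v)>t$, set $\sigma(v)=t$ and push $(v,d_u+1,t,\text{popped record})$. The BFS tree $T$ has as nodes all records ever pushed (each an occurrence of its vertex; the initial one is the root), each non-root record a child of its final predecessor record. For an occurrence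 $v_o$, $dist(v_o)$ is the hop count in its record.
   Formalization: The times of the temporal edges and the starting time $t_s$ are rational rather than real. -}

module Defs where

open import Data.Nat using (ℕ; zero; suc; _<_)
open import Data.Nat.Properties using () renaming (_≟_ to _≟ℕ_)
open import Data.Fin using (Fin) renaming (_≟_ to _≟F_)
open import Data.Rational using (ℚ) renaming (_<_ to _<ℚ_; _≤_ to _≤ℚ_)
open import Data.Rational.Properties using () renaming (_<?_ to _<ℚ?_)
open import Data.Bool using (Bool; true; false; if_then_else_; _∧_)
open import Data.Maybe using (Maybe; just; nothing)
open import Data.Product using (_×_; _,_; Σ; ∃)
open import Data.List using (List; []; _∷_; _++_; [_])
open import Data.List.Membership.Propositional using (_∈_; _∉_)
open import Data.List.Relation.Unary.All using (All)
open import Data.List.Relation.Unary.Unique.Propositional using (Unique)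
open import Relation.Nullary using (¬_; does)
open import Relation.Binary.PropositionalEquality using (_≡_; _≢_)
open import Relation.Binary.Construct.Closure.ReflexiveTransitive using (Star)

record TEdge (n : ℕ) : Set where
  constructor edge
  field
    src  : Fin n
    tgt  : Fin n
    time : ℚ
open TEdge public

-- E is a finite *set* of temporal edges (u,v,t) with u ≠ v; as a set,
-- distinct edges from u to v automatically have distinct times.
record TemporalGraph : Set where
  field
    n      : ℕ
    edges  : List (TEdge n)
    noLoop : All (λ e → src e ≢ tgt e) edges
    isSet  : Unique edges
open TemporalGraph public

-- Records (x, d, τ, p) of the BFS.  Each pushed record gets an identifier
-- (its push index); the predecessor is the identifier of a record.

record Rec (n : ℕ) : Set where
  constructor rec
  field
    vtx  : Fin n
    hop  : ℕ
    tm   : ℚ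
    pred : Maybe ℕ
open Rec public

-- BFS state.
--   σ        : σ(x), with nothing = ∞
--   queue    : the FIFO queue Q (identifiers of records, head = front)
--   recs     : record store; records 0 .. count-1 are all records ever pushed
--   count    : number of records pushed so far
--   traversed: the temporal edges already traversed
--   current  : nothing between iterations; just (i , done) while processing the
--              popped record i, where done = out-neighbours already handled
record State (n : ℕ) : Set where
  constructor st
  field
    σ         : Fin n → Maybe ℚ
    queue     : List ℕ
    recs      : ℕ → Rec n
    count     : ℕ
    traversed : List (TEdge n)
    current   : Maybe (ℕ × List (Fin n))
open State public

improves : Maybe ℚ → ℚ → Bool
improves nothing  t = true
improves (just x) t = does (t <ℚ? x)

hasRecOf : ∀ {n} → (ℕ → Rec n) → Fin n → List ℕ → Bool
hasRecOf R v []      = false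
hasRecOf R v (j ∷ q) = if does (vtx (R j) ≟F v) then true else hasRecOf R v q

findRec : ∀ {n} → (ℕ → Rec n) → Fin n → ℕ → List ℕ → Maybe ℕ
findRec R v h []      = nothing
findRec R v h (j ∷ q) =
  if does (vtx (R j) ≟F v) ∧ does (hop (R j) ≟ℕ h) then just j else findRec R v h q

updσ : ∀ {n} → (Fin n → Maybe ℚ) → Fin n → ℚ → Fin n → Maybe ℚ
updσ σ v t x = if does (x ≟F v) then just t else σ x

updR : ∀ {n} → (ℕ → Rec n) → ℕ → Rec n → ℕ → Rec n
updR R j r k = if does (k ≟ℕ j) then r else R k

push : ∀ {n} → State n → Fin n → ℕ → ℚ → ℕ → State n
push S v d t i = record S
  { σ     = updσ (σ S) v t
  ; queue = queue S ++ [ count S ]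
  ; recs  = updR (recs S) (count S) (rec v (suc d) t (just i))
  ; count = suc (count S) }

relax : ∀ {n} → State n → Fin n → ℚ → ℕ → State n
relax S v t i with recs S i
... | rec u d τ p with hasRecOf (recs S) v (queue S)
...   | false = if improves (σ S v) t then push S v d t i else S
...   | true with findRec (recs S) v (suc d) (queue S)
...     | just j = if improves (σ S v) t
                   then record S { σ = updσ (σ S) v t
                                 ; recs = updR (recs S) j (rec v (suc d) t (just i)) }
                   else S
...     | nothing = if improves (σ S v) t then push S v d t i else S

Eligible : ∀ {n} → List (TEdge n) → List (TEdge n) → Fin n → ℚ → Fin n → TEdge n → Set
Eligible E tr u τ v e = e ∈ E × e ∉ tr × src e ≡ u × tgt e ≡ v × τ ≤ℚ time e

-- One step of the BFS from s (the order in which out-neighbours are handled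
-- is left arbitrary).

data Step (G : TemporalGraph) : State (n G) → State (n G) → Set where
  pop : ∀ {S i q} → queue S ≡ i ∷ q → current S ≡ nothing →
        Step G S (record S { queue = q ; current = just (i , []) })
  traverse : ∀ {S i done} (e : TEdge (n G)) →
        current S ≡ just (i , done) →
        tgt e ∉ done →
        Eligible (edges G) (traversed S) (vtx (recs S i)) (tm (recs S i)) (tgt e) e →
        (∀ e′ → Eligible (edges G) (traversed S) (vtx (recs S i)) (tm (recs S i)) (tgt e) e′ →
                time e ≤ℚ time e′) →
        Step G S (relax (record S { traversed = e ∷ traversed S
                                  ; current = just (i , tgt e ∷ done) })
                        (tgt e) (time e) i)
  finish : ∀ {S i done} → current S ≡ just (i , done) →
        (∀ v e → v ∉ done →
           ¬ Eligible (edges G) (traversed S) (vtx (recs S i)) (tm (recs S i)) v e) →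
        Step G S (record S { current = nothing })

initState : ∀ {n} → Fin n → ℚ → State n
initState s ts = st (λ x → if does (x ≟F s) then just ts else nothing)
                    (0 ∷ []) (λ _ → rec s 0 ts nothing) 1 [] nothing

Final : ∀ {n} → State n → Set
Final S = queue S ≡ [] × current S ≡ nothing

BFSRun : (G : TemporalGraph) → Fin (n G) → ℚ → State (n G) → Set
BFSRun G s ts S = Star (Step G) (initState s ts) S × Final S

-- The BFS tree T: nodes = records 0 .. count-1, parent = final predecessor.

Node : ∀ {n} → State n → Set
Node S = Σ ℕ (λ i → i < count S)

parent : ∀ {n} (S : State n) → Node S → Maybe ℕ
parent S (i , _) = pred (recs S i)

IsOcc : ∀ {n} (S : State n) → Fin n → Node S → Set
IsOcc S v (i , _) = vtx (recs S i) ≡ v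

dist : ∀ {n} (S : State n) → Node S → ℕ
dist S (i , _) = hop (recs S i)

{-# OPTIONS --safe #-}
module Submission where

-- Throughout the run there is a level L (the hop count of the record being
-- processed) such that the hop counts in the queue are sorted and lie in
-- {L, L+1}, every record of hop count > L is still in the queue, and no two
-- records share both vertex and hop count.  A record (v, L+1) is pushed only
-- when the queue holds no record of v with hop count L+1 (rule (i): none of v
-- at all; rule (iii): the search for one failed), and by the second property
-- there is then no such record anywhere.  Rule (ii) replaces a record by one
-- with the same vertex and hop count.

open import Defs
open import Data.Bool using (true; false; if_then_else_; T)
open import Data.Fin using (Fin) renaming (_≟_ to _≟F_)
open import Data.List using (List; []; _∷_; _++_; [_]; map)
open import Data.List.Membership.Propositional using (_∈_)
open import Data.List.Membership.Propositional.Properties using (∈-++⁺ˡ; ∈-++⁺ʳ)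
open import Data.List.Properties using (map-cong-local; map-++)
open import Data.List.Relation.Unary.All as All using (All; []; _∷_)
import Data.List.Relation.Unary.All.Properties as All
open import Data.List.Relation.Unary.AllPairs using (AllPairs; []; _∷_)
import Data.List.Relation.Unary.AllPairs.Properties as AllPairs
open import Data.List.Relation.Unary.Any using (here; there)
open import Data.Maybe using (Maybe; just; nothing)
open import Data.Nat using (ℕ; suc; _≤_; _<_; _≡ᵇ_; z≤n; s≤s)
open import Data.Nat.Properties
  using (≤-refl; ≤-reflexive; ≤-trans; ≤-<-trans; <-irrefl; <⇒≢; m<n⇒m<1+n; n<1+n; n≤1+n; m<1+n⇒m<n∨m≡n; ≡⇒≡ᵇ; ≡ᵇ⇒≡)
  renaming (_≟_ to _≟ℕ_)
open import Data.Product using (∃; _×_; _,_; proj₁; proj₂; map₁)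
open import Data.Rational using (ℚ)
open import Data.Sum using (inj₁; inj₂)
open import Data.Unit using (tt)
open import Data.Empty using (⊥-elim)
open import Function using (_∘_)
open import Relation.Nullary using (yes; no)
open import Relation.Nullary.Decidable using (dec-true; dec-false)
open import Relation.Binary.PropositionalEquality using (_≡_; _≢_; refl; sym; trans; cong; cong₂; subst; module ≡-Reasoning)
open import Relation.Binary.Construct.Closure.ReflexiveTransitive using (Star; ε; _◅_)

private
  variable
    m : ℕ

key : Rec m → Fin m × ℕ
key r = vtx r , hop r

updR-≡ : (R : ℕ → Rec m) (j : ℕ) (r : Rec m) → updR R j r j ≡ r
updR-≡ R j r = cong (λ b → if b then r else R j) (dec-true (j ≟ℕ j) refl)

updR-≢ : (R : ℕ → Rec m) {j k : ℕ} (r : Rec m) → k ≢ j → updR R j r k ≡ R k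
updR-≢ R {j} {k} r k≢j = cong (λ b → if b then r else R k) (dec-false (k ≟ℕ j) k≢j)

updR-key : (R : ℕ → Rec m) {j : ℕ} {r : Rec m} → key r ≡ key (R j) →
           ∀ k → key (updR R j r k) ≡ key (R k)
updR-key R {j} {r} r≈Rj k with k ≟ℕ j
... | yes refl = trans (cong key (updR-≡ R k r)) r≈Rj
... | no k≢j   = cong key (updR-≢ R r k≢j)

hasRecOf-false : ∀ {R : ℕ → Rec m} {v} q → hasRecOf R v q ≡ false → All (λ b → vtx (R b) ≢ v) q
hasRecOf-false []                  _  = []
hasRecOf-false {R = R} {v} (j ∷ q) no-rec with vtx (R j) ≟F v
hasRecOf-false (j ∷ q) () | yes _
... | no Rj≢v = Rj≢v ∷ hasRecOf-false q no-rec

findRec-just : ∀ {R : ℕ → Rec m} {v h j} q → findRec R v h q ≡ just j → key (R j) ≡ (v , h)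
findRec-just {R = R} {v} {h} (k ∷ q) found with vtx (R k) ≟F v | hop (R k) ≡ᵇ h in hk
findRec-just (k ∷ q) refl | yes refl | true = cong (_ ,_) (≡ᵇ⇒≡ _ _ (subst T (sym hk) tt))
... | yes _ | false = findRec-just q found
... | no _  | _     = findRec-just q found

findRec-nothing : ∀ {R : ℕ → Rec m} {v h} q → findRec R v h q ≡ nothing → All (λ b → key (R b) ≢ (v , h)) q
findRec-nothing []                     _    = []
findRec-nothing {R = R} {v} {h} (k ∷ q) none with vtx (R k) ≟F v | hop (R k) ≡ᵇ h in hk
findRec-nothing (k ∷ q) () | yes _ | true
... | yes _   | false = (λ Rk≈vh → subst T hk (≡⇒≡ᵇ _ _ (cong proj₂ Rk≈vh))) ∷ findRec-nothing q none
... | no Rk≢v | _     = (Rk≢v ∘ cong proj₁) ∷ findRec-nothing q none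

if-both : ∀ {a} {A : Set a} (P : A → Set) b {x y : A} → P x → P y → P (if b then x else y)
if-both P true  px _  = px
if-both P false _  py = py

Layered : ℕ → List ℕ → Set
Layered L hs = All (λ h → L ≤ h × h ≤ suc L) hs × AllPairs _≤_ hs

layered-snoc : ∀ {L hs} → Layered L hs → Layered L (hs ++ [ suc L ])
layered-snoc (bounds , sorted) =
  All.++⁺ bounds ((n≤1+n _ , ≤-refl) ∷ []) ,
  AllPairs.++⁺ sorted ([] ∷ []) (All.map (λ (_ , h≤1+L) → h≤1+L ∷ []) bounds)

layered-pop : ∀ {L h hs} → Layered L (h ∷ hs) → Layered h hs
layered-pop (((L≤h , _) ∷ bounds) , (h≤hs ∷ sorted)) =
  All.zipWith (λ (h≤x , (_ , x≤1+L)) → h≤x , ≤-trans x≤1+L (s≤s L≤h)) (h≤hs , bounds) , sorted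

record BFSInv (R : ℕ → Rec m) (c : ℕ) (q : List ℕ) (cur : Maybe (ℕ × List (Fin m))) (L : ℕ) : Set where
  field
    queue-bounded : All (_< c) q
    queue-layered : Layered L (map (hop ∘ R) q)
    deeper-queued : ∀ {j} → j < c → L < hop (R j) → j ∈ q
    key-injective : ∀ {a b} → a < c → b < c → key (R a) ≡ key (R b) → a ≡ b
    current-level : ∀ {i done} → cur ≡ just (i , done) → i < c × hop (R i) ≡ L
open BFSInv

-- Stated on the components it reads, so that updates of σ and of the
-- traversed edges leave it unchanged definitionally.
Inv : State m → ℕ → Set
Inv S = BFSInv (recs S) (count S) (queue S) (current S)

module _ {R : ℕ → Rec m} {c q cur L} (I : BFSInv R c q cur L) where

  open ≡-Reasoning

  respects-keys : ∀ {R′} → (∀ {k} → k < c → key (R′ k) ≡ key (R k)) → BFSInv R′ c q cur L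
  respects-keys {R′} R′≈R = record
    { queue-bounded = queue-bounded I
    ; queue-layered = subst (Layered L) (sym (map-cong-local (All.map hop≈ (queue-bounded I)))) (queue-layered I)
    ; deeper-queued = λ j<c L<hop → deeper-queued I j<c (subst (L <_) (hop≈ j<c) L<hop)
    ; key-injective = λ a<c b<c Ra≈Rb → key-injective I a<c b<c (trans (sym (R′≈R a<c)) (trans Ra≈Rb (R′≈R b<c)))
    ; current-level = λ cur≡ → let (i<c , hi≡L) = current-level I cur≡ in i<c , trans (hop≈ i<c) hi≡L
    }
    where
    hop≈ : ∀ {k} → k < c → hop (R′ k) ≡ hop (R k)
    hop≈ = cong proj₂ ∘ R′≈R

  enqueue : hop (R c) ≡ suc L → All (λ b → key (R b) ≢ key (R c)) q → BFSInv R (suc c) (q ++ [ c ]) cur L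
  enqueue hc≡1+L fresh = record
    { queue-bounded = All.++⁺ (All.map m<n⇒m<1+n (queue-bounded I)) (n<1+n c ∷ [])
    ; queue-layered = subst (Layered L) (sym hops≡) (layered-snoc (queue-layered I))
    ; deeper-queued = deeper
    ; key-injective = injective
    ; current-level = λ cur≡ → map₁ m<n⇒m<1+n (current-level I cur≡)
    }
    where
    hops≡ : map (hop ∘ R) (q ++ [ c ]) ≡ map (hop ∘ R) q ++ [ suc L ]
    hops≡ = begin
      map (hop ∘ R) (q ++ [ c ])          ≡⟨ map-++ (hop ∘ R) q [ c ] ⟩
      map (hop ∘ R) q ++ [ hop (R c) ]    ≡⟨ cong (λ h → map (hop ∘ R) q ++ [ h ]) hc≡1+L ⟩
      map (hop ∘ R) q ++ [ suc L ]        ∎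

    old-key-differs : ∀ {b} → b < c → key (R b) ≢ key (R c)
    old-key-differs b<c Rb≈Rc =
      All.lookup fresh (deeper-queued I b<c (≤-reflexive (sym (trans (cong proj₂ Rb≈Rc) hc≡1+L)))) Rb≈Rc

    deeper : ∀ {j} → j < suc c → L < hop (R j) → j ∈ q ++ [ c ]
    deeper j<1+c L<hop with m<1+n⇒m<n∨m≡n j<1+c
    ... | inj₁ j<c  = ∈-++⁺ˡ (deeper-queued I j<c L<hop)
    ... | inj₂ refl = ∈-++⁺ʳ q (here refl)

    injective : ∀ {a b} → a < suc c → b < suc c → key (R a) ≡ key (R b) → a ≡ b
    injective a<1+c b<1+c Ra≈Rb with m<1+n⇒m<n∨m≡n a<1+c | m<1+n⇒m<n∨m≡n b<1+c
    ... | inj₁ a<c  | inj₁ b<c  = key-injective I a<c b<c Ra≈Rb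
    ... | inj₁ a<c  | inj₂ refl = ⊥-elim (old-key-differs a<c Ra≈Rb)
    ... | inj₂ refl | inj₁ b<c  = ⊥-elim (old-key-differs b<c (sym Ra≈Rb))
    ... | inj₂ refl | inj₂ refl = refl

  change-current : ∀ {cur′} → (∀ {i done} → cur′ ≡ just (i , done) → i < c × hop (R i) ≡ L) →
                   BFSInv R c q cur′ L
  change-current level = record
    { queue-bounded = queue-bounded I
    ; queue-layered = queue-layered I
    ; deeper-queued = deeper-queued I
    ; key-injective = key-injective I
    ; current-level = level
    }

  dequeue : ∀ {i q′ done} → q ≡ i ∷ q′ → BFSInv R c q′ (just (i , done)) (hop (R i))
  dequeue {i} {q′} refl = record
    { queue-bounded = All.tail (queue-bounded I)
    ; queue-layered = layered-pop (queue-layered I)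
    ; deeper-queued = deeper
    ; key-injective = key-injective I
    ; current-level = λ { refl → All.head (queue-bounded I) , refl }
    }
    where
    L≤hi : L ≤ hop (R i)
    L≤hi = proj₁ (All.head (proj₁ (queue-layered I)))

    deeper : ∀ {j} → j < c → hop (R i) < hop (R j) → j ∈ q′
    deeper j<c hi<hj with deeper-queued I j<c (≤-<-trans L≤hi hi<hj)
    ... | here refl = ⊥-elim (<-irrefl refl hi<hj)
    ... | there j∈q′ = j∈q′

push-preserves : ∀ {R : ℕ → Rec m} {c q cur L r} → BFSInv R c q cur L → hop r ≡ suc L →
                 All (λ b → key (R b) ≢ key r) q → BFSInv (updR R c r) (suc c) (q ++ [ c ]) cur L
push-preserves {R = R} {c} {r = r} I hr≡1+L fresh =
  enqueue (respects-keys I (cong key ∘ below)) (trans (cong hop at-c) hr≡1+L)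
    (All.zipWith (λ (b<c , Rb≢r) R′b≈R′c → Rb≢r (trans (sym (cong key (below b<c))) (trans R′b≈R′c (cong key at-c))))
                 (queue-bounded I , fresh))
  where
  below : ∀ {k} → k < c → updR R c r k ≡ R k
  below k<c = updR-≢ R r (<⇒≢ k<c)
  at-c : updR R c r c ≡ r
  at-c = updR-≡ R c r

overwrite-preserves : ∀ {R : ℕ → Rec m} {c q cur L j r} → BFSInv R c q cur L → key r ≡ key (R j) →
                      BFSInv (updR R j r) c q cur L
overwrite-preserves {R = R} I r≈Rj = respects-keys I (λ {k} _ → updR-key R r≈Rj k)

relax-preserves : ∀ {L} (S : State m) v t i → Inv S L → hop (recs S i) ≡ L → Inv (relax S v t i) L
relax-preserves S v t i I hi≡L with recs S i | hi≡L
... | rec _ d _ _ | refl with hasRecOf (recs S) v (queue S) in has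
...   | false = if-both (λ S′ → Inv S′ d) (improves (σ S v) t)
                  (push-preserves I refl (All.map (_∘ cong proj₁) (hasRecOf-false (queue S) has))) I
...   | true with findRec (recs S) v (suc d) (queue S) in found
...     | just j  = if-both (λ S′ → Inv S′ d) (improves (σ S v) t)
                      (overwrite-preserves I (sym (findRec-just (queue S) found))) I
...     | nothing = if-both (λ S′ → Inv S′ d) (improves (σ S v) t)
                      (push-preserves I refl (findRec-nothing (queue S) found)) I

step-preserves : ∀ {G S S′ L} → Step G S S′ → Inv S L → ∃ (Inv S′)
step-preserves {S = S} (pop {i = i} q≡ _) I = hop (recs S i) , dequeue I q≡
step-preserves {L = L} (traverse {S = S} {i = i} e cur≡ _ _ _) I =
  L , relax-preserves _ (tgt e) (time e) i (change-current I λ { refl → current-level I cur≡ })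
                      (proj₂ (current-level I cur≡))
step-preserves (finish _ _) I = _ , change-current I λ ()

run-preserves : ∀ {G S S′ L} → Star (Step G) S S′ → Inv S L → ∃ (Inv S′)
run-preserves ε         I = _ , I
run-preserves (s ◅ run) I = run-preserves run (proj₂ (step-preserves s I))

initState-Inv : (s : Fin m) (ts : ℚ) → Inv (initState s ts) 0
initState-Inv s ts = record
  { queue-bounded = s≤s z≤n ∷ []
  ; queue-layered = (z≤n , z≤n) ∷ [] , [] ∷ []
  ; deeper-queued = λ _ ()
  ; key-injective = λ { (s≤s z≤n) (s≤s z≤n) _ → refl }
  ; current-level = λ ()
  }

lemma10 : (G : TemporalGraph) (s : Fin (n G)) (ts : ℚ) (T : State (n G)) →
    BFSRun G s ts T →
    (v : Fin (n G)) (o₁ o₂ : Node T) →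
    IsOcc T v o₁ → IsOcc T v o₂ → proj₁ o₁ ≢ proj₁ o₂ →
    dist T o₁ ≢ dist T o₂
lemma10 G s ts T (run , _) v (a , a<c) (b , b<c) a∈Ov b∈Ov a≢b da≡db =
  a≢b (key-injective (proj₂ (run-preserves run (initState-Inv s ts))) a<c b<c (cong₂ _,_ (trans a∈Ov (sym b∈Ov)) da≡db))
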